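{- Let $k$ be an integer and let $n$ be an integer with $n > \max(k,0)$. Then $a^{n-k+1} \equiv a \pmod{n}$ holds for all integers $a$ if and only if $n$ is squarefree and $\lambda(n)$ divides $n-k$.
   Context: $\lambda(n)$ denotes the Carmichael function: the greatest order of an element of the multiplicative group $(\mathbb{Z}/n\mathbb{Z})^\times$ (equivalently, the exponent of that group). For squarefree $n$ with prime factors $p_1,\dots,p_r$, $\lambda(n)=\operatorname{lcm}(p_1-1,\dots,p_r-1)$. -}

module Defs where

open import Data.Nat using (ℕ; _*_; _^_; _<_; _%_; NonZero)
open import Data.Nat.Divisibility using (_∣_)
open import Data.Nat.Primality using (Prime)
open import Data.Nat.Coprimality using (Coprime)
open import Data.Product using (_×_)
open import Relation.Nullary using (¬_)
open import Relation.Binary.PropositionalEquality using (_≡_)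

SquareFree : ℕ → Set
SquareFree n = ∀ p → Prime p → ¬ (p * p ∣ n)

KillsUnits : (n : ℕ) → .{{NonZero n}} → ℕ → Set
KillsUnits n m = ∀ a → a < n → Coprime a n → (a ^ m) % n ≡ 1 % n

IsCarmichaelλ : (n : ℕ) → .{{NonZero n}} → ℕ → Set
IsCarmichaelλ n L =
  (0 < L) × KillsUnits n L × (∀ m → 0 < m → KillsUnits n m → L Data.Nat.≤ m)

module Submission where

-- With m = n - k ≥ 1.  If a^(m+1) ≡ a (mod n) for all a, then a prime p with
-- p² ∣ n would give p² ∣ p^(m+1) - p and p² ∣ p^(m+1), hence p² ∣ p; and
-- cancelling a unit a from a(a^m - 1) shows that m kills (ℤ/nℤ)^×.  The
-- exponents killing the units are closed under remainders, so the least
-- positive one, λ(n), divides m.  Conversely, for squarefree n put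
-- d = gcd(a, n) and n = d e, so gcd(d, e) = 1; then a + e is a unit mod n,
-- whence a^m ≡ (a + e)^m ≡ 1 (mod e), and with d ∣ a this gives
-- n = d e ∣ a (a^m - 1).

open import Defs
open import Data.Nat using (ℕ; NonZero)
open import Data.Integer using (ℤ; +_; _-_; _^_; _<_; ∣_∣)
open import Data.Integer.Divisibility using (_∣_)
open import Data.Nat.Divisibility using () renaming (_∣_ to _∣ℕ_)
open import Data.Product using (_×_; ∃)
open import Function.Bundles using (_⇔_)

open import Level using (0ℓ)
open import Data.Empty using (⊥-elim)
open import Data.Sum using (inj₁; inj₂)
open import Data.Product using (_,_)
open import Data.Product.Function.NonDependent.Propositional using (_×-⇔_)
open import Data.List using ([]; _∷_)
open import Data.List.Relation.Unary.All using (_∷_)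
open import Function.Bundles using (mk⇔; module Equivalence)
open import Function.Construct.Identity using (⇔-id)
open import Function.Properties.Equivalence using (⇔-setoid)
open import Relation.Nullary using (yes; no)
import Relation.Nullary.Decidable as Dec
open import Relation.Unary using (Pred; Decidable)
open import Relation.Binary.Bundles using (Setoid)
open import Relation.Binary.Structures using (IsEquivalence)
open import Relation.Binary.PropositionalEquality
import Relation.Binary.Reasoning.Setoid as SetoidReasoning

import Data.Nat as ℕ
import Data.Nat.Properties as ℕ
open import Data.Nat using (zero; suc; _%_; _≤_)
open import Data.Nat.Properties
  using (≤-total; ≮⇒≥; <⇒≱; n≤0⇒n≡0; n≢0⇒n>0; anyUpTo?; allUpTo?; _<?_; _≟_)
open import Data.Nat.Induction using (<-rec)
open import Data.Nat.DivMod using (_/_; m≡m%n+[m/n]*n; [m+kn]%n≡m%n; m%n<n)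
open import Data.Nat.Divisibility
  using (∣1⇒≡1; ∣-trans; *-pres-∣; *-cancelˡ-∣; 0∣⇒≡0; m%n≡0⇒n∣m)
  renaming (divides to dividesℕ)
open import Data.Nat.GCD using (gcd; gcd[m,n]∣m; gcd[m,n]∣n; gcd-greatest)
open import Data.Nat.Coprimality using (Coprime; coprime?; coprime-divisor)
import Data.Nat.Coprimality as Coprimality
open import Data.Nat.Primality using (Prime; ¬prime[1]; prime⇒nonZero)
open import Data.Nat.Primality.Factorisation using (factorise)
open import Data.Nat.ListAction using (product)

open import Data.Integer using (0ℤ; 1ℤ; _+_; _*_; -_; _%ℕ_; _/ℕ_)
open import Data.Integer.Properties
  using (+-inverseʳ; *-zeroˡ; *-identityʳ; ^-zeroˡ; ^-*-assoc; ^-distribˡ-+-*; pos-*;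
         m-n≡m⊖n; ⊖-≥; <-irrefl; i-j≡0⇒i≡j; ∣i∣≡0⇒i≡0)
open import Data.Integer.DivMod using (a≡a%ℕn+[a/ℕn]*n; n%ℕd<d)
import Data.Integer.Coprimality as ℤCoprimality
import Data.Integer.Divisibility.Signed as ℤ∣
open import Data.Integer.Divisibility.Signed
  using (divides; ∣m∣n⇒∣m+n; ∣m∣n⇒∣m-n; ∣m+n∣m⇒∣n; ∣m+n∣n⇒∣m; ∣m⇒∣-m; ∣n⇒∣m*n; ∣m⇒∣m*n)
  renaming (_∣_ to _∣ₛ_)
open import Data.Integer.Tactic.RingSolver using (solve-∀)

open Equivalence using (to; from)

private variable
  x y z u v m : ℤ

infix 4 _≡_mod_
-- A record rather than a synonym for  m ∣ x - y  so that x, y and m can be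
-- inferred from a congruence.
record _≡_mod_ (x y m : ℤ) : Set where
  constructor mod∣
  field ∣-difference : m ∣ₛ x - y

open _≡_mod_ public

≡-mod-refl : x ≡ x mod m
≡-mod-refl {x} {m} = mod∣ (divides 0ℤ (trans (+-inverseʳ x) (sym (*-zeroˡ m))))

≡-mod-sym : x ≡ y mod m → y ≡ x mod m
≡-mod-sym {x} {y} {m} (mod∣ m∣x-y) = mod∣ (subst (m ∣ₛ_) (negate x y) (∣m⇒∣-m m∣x-y))
  where
  negate : ∀ x y → - (x - y) ≡ y - x
  negate = solve-∀

≡-mod-trans : x ≡ y mod m → y ≡ z mod m → x ≡ z mod m
≡-mod-trans {x} {y} {m} {z} (mod∣ m∣x-y) (mod∣ m∣y-z) =
  mod∣ (subst (m ∣ₛ_) (telescope x y z) (∣m∣n⇒∣m+n m∣x-y m∣y-z))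
  where
  telescope : ∀ x y z → (x - y) + (y - z) ≡ x - z
  telescope = solve-∀

≡-mod-isEquivalence : (m : ℤ) → IsEquivalence (λ x y → x ≡ y mod m)
≡-mod-isEquivalence m = record
  { refl = ≡-mod-refl ; sym = ≡-mod-sym ; trans = ≡-mod-trans }

≡-mod-setoid : ℤ → Setoid _ _
≡-mod-setoid m = record { isEquivalence = ≡-mod-isEquivalence m }

module ≡-mod-Reasoning (m : ℤ) = SetoidReasoning (≡-mod-setoid m)

*-cong-mod : x ≡ y mod m → u ≡ v mod m → x * u ≡ y * v mod m
*-cong-mod {x} {y} {m} {u} {v} (mod∣ m∣x-y) (mod∣ m∣u-v) =
  mod∣ (subst (m ∣ₛ_) (split x y u v) (∣m∣n⇒∣m+n (∣n⇒∣m*n x m∣u-v) (∣m⇒∣m*n v m∣x-y)))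
  where
  split : ∀ x y u v → x * (u - v) + (x - y) * v ≡ x * u - y * v
  split = solve-∀

^-cong-mod : ∀ j → x ≡ y mod m → x ^ j ≡ y ^ j mod m
^-cong-mod zero    x≡y = ≡-mod-refl
^-cong-mod (suc j) x≡y = *-cong-mod x≡y (^-cong-mod j x≡y)

^-≡1-mod : ∀ j → x ≡ 1ℤ mod m → x ^ j ≡ 1ℤ mod m
^-≡1-mod {x} {m} j x≡1 = begin
  x ^ j   ≈⟨ ^-cong-mod j x≡1 ⟩
  1ℤ ^ j  ≡⟨ ^-zeroˡ j ⟩
  1ℤ      ∎
  where open ≡-mod-Reasoning m

≡-mod-∣ : ∀ {d} → d ∣ₛ m → x ≡ y mod m → x ≡ y mod d
≡-mod-∣ d∣m (mod∣ m∣x-y) = mod∣ (ℤ∣.∣-trans d∣m m∣x-y)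

≡-mod-+-modulus : x + m ≡ x mod m
≡-mod-+-modulus {x} {m} = mod∣ (divides 1ℤ (cancel x m))
  where
  cancel : ∀ x m → (x + m) - x ≡ 1ℤ * m
  cancel = solve-∀

∣⇔≡-mod : m ∣ x - y ⇔ x ≡ y mod m
∣⇔≡-mod = mk⇔ (λ m∣x-y → mod∣ (ℤ∣.∣ᵤ⇒∣ m∣x-y)) (λ x≡y → ℤ∣.∣⇒∣ᵤ (∣-difference x≡y))

x*y-x≡x*[y-1] : ∀ x y → x * y - x ≡ x * (y - 1ℤ)
x*y-x≡x*[y-1] = solve-∀

pos-^ : ∀ a j → + (a ℕ.^ j) ≡ (+ a) ^ j
pos-^ a zero    = refl
pos-^ a (suc j) = trans (pos-* a (a ℕ.^ j)) (cong (+ a *_) (pos-^ a j))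

module _ {n : ℕ} .{{_ : NonZero n}} where

  ≡-mod-%ℕ : ∀ b → b ≡ + (b %ℕ n) mod + n
  ≡-mod-%ℕ b = mod∣ (divides (b /ℕ n) (begin
    b - r                     ≡⟨ cong (_- r) (a≡a%ℕn+[a/ℕn]*n b n) ⟩
    (r + b /ℕ n * + n) - r    ≡⟨ cancel r (b /ℕ n * + n) ⟩
    b /ℕ n * + n              ∎))
    where
    open ≡-Reasoning
    r = + (b %ℕ n)
    cancel : ∀ r t → (r + t) - r ≡ t
    cancel = solve-∀

  %≡%⇒≡-mod : ∀ x y → x % n ≡ y % n → + x ≡ + y mod + n
  %≡%⇒≡-mod x y x%n≡y%n = begin
    + x        ≈⟨ ≡-mod-%ℕ (+ x) ⟩
    + (x % n)  ≡⟨ cong +_ x%n≡y%n ⟩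
    + (y % n)  ≈⟨ ≡-mod-sym (≡-mod-%ℕ (+ y)) ⟩
    + y        ∎
    where open ≡-mod-Reasoning (+ n)

  ≤∧≡-mod⇒%≡% : ∀ {x y} → y ≤ x → + x ≡ + y mod + n → x % n ≡ y % n
  ≤∧≡-mod⇒%≡% {x} {y} y≤x (mod∣ n∣x-y) = begin
    x % n                      ≡⟨ cong (_% n) (ℕ.m+[n∸m]≡n y≤x) ⟨
    (y ℕ.+ (x ℕ.∸ y)) % n      ≡⟨ cong (λ t → (y ℕ.+ t) % n) (_∣ℕ_.equality n∣x∸y) ⟩
    (y ℕ.+ q ℕ.* n) % n        ≡⟨ [m+kn]%n≡m%n y q n ⟩
    y % n                      ∎
    where
    open ≡-Reasoning
    n∣x∸y : n ∣ℕ x ℕ.∸ y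
    n∣x∸y = subst (n ∣ℕ_) (cong ∣_∣ (trans (m-n≡m⊖n x y) (⊖-≥ y≤x))) (ℤ∣.∣⇒∣ᵤ n∣x-y)
    q = _∣ℕ_.quotient n∣x∸y

  ≡-mod⇒%≡% : ∀ x y → + x ≡ + y mod + n → x % n ≡ y % n
  ≡-mod⇒%≡% x y x≡y with ≤-total y x
  ... | inj₁ y≤x = ≤∧≡-mod⇒%≡% y≤x x≡y
  ... | inj₂ x≤y = sym (≤∧≡-mod⇒%≡% x≤y (≡-mod-sym x≡y))

  coprime-%ℕ : ∀ b → Coprime ∣ b ∣ n → Coprime (b %ℕ n) n
  coprime-%ℕ b b⊥n {i} (i∣r , i∣n) = b⊥n (ℤ∣.∣⇒∣ᵤ i∣b , i∣n)
    where
    i∣b : + i ∣ₛ b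
    i∣b = subst (+ i ∣ₛ_) (sym (a≡a%ℕn+[a/ℕn]*n b n))
      (∣m∣n⇒∣m+n (ℤ∣.∣ᵤ⇒∣ {+ i} {+ (b %ℕ n)} i∣r) (∣n⇒∣m*n (b /ℕ n) (ℤ∣.∣ᵤ⇒∣ {+ i} {+ n} i∣n)))

KillsUnitsℤ : ℕ → ℕ → Set
KillsUnitsℤ n j = ∀ b → Coprime ∣ b ∣ n → b ^ j ≡ 1ℤ mod + n

killsUnits⇔killsUnitsℤ : ∀ {n} .{{_ : NonZero n}} j → KillsUnits n j ⇔ KillsUnitsℤ n j
killsUnits⇔killsUnitsℤ {n} j = mk⇔ kills⇒killsℤ killsℤ⇒kills
  where
  kills⇒killsℤ : KillsUnits n j → KillsUnitsℤ n j
  kills⇒killsℤ kills b b⊥n = begin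
    b ^ j         ≈⟨ ^-cong-mod j (≡-mod-%ℕ b) ⟩
    (+ r) ^ j     ≡⟨ pos-^ r j ⟨
    + (r ℕ.^ j)   ≈⟨ %≡%⇒≡-mod (r ℕ.^ j) 1 (kills r (n%ℕd<d b n) (coprime-%ℕ b b⊥n)) ⟩
    1ℤ            ∎
    where
    open ≡-mod-Reasoning (+ n)
    r = b %ℕ n

  killsℤ⇒kills : KillsUnitsℤ n j → KillsUnits n j
  killsℤ⇒kills kills a _ a⊥n =
    ≡-mod⇒%≡% (a ℕ.^ j) 1 (subst (_≡ 1ℤ mod + n) (sym (pos-^ a j)) (kills (+ a) a⊥n))

killsUnitsℤ-∣ : ∀ {n l j} → l ∣ℕ j → KillsUnitsℤ n l → KillsUnitsℤ n j
killsUnitsℤ-∣ {n} {l} (dividesℕ q refl) kills b b⊥n = begin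
  b ^ (q ℕ.* l)  ≡⟨ cong (b ^_) (ℕ.*-comm q l) ⟩
  b ^ (l ℕ.* q)  ≡⟨ ^-*-assoc b l q ⟨
  (b ^ l) ^ q    ≈⟨ ^-≡1-mod q (kills b b⊥n) ⟩
  1ℤ             ∎
  where open ≡-mod-Reasoning (+ n)

killsUnitsℤ-% : ∀ {n l j} .{{_ : NonZero l}} →
                KillsUnitsℤ n l → KillsUnitsℤ n j → KillsUnitsℤ n (j % l)
killsUnitsℤ-% {n} {l} {j} killsˡ killsʲ b b⊥n = begin
  b ^ r                  ≡⟨ *-identityʳ (b ^ r) ⟨
  b ^ r * 1ℤ             ≈⟨ *-cong-mod (≡-mod-refl {b ^ r}) (≡-mod-sym b^ql≡1) ⟩
  b ^ r * b ^ (q ℕ.* l)  ≡⟨ ^-distribˡ-+-* b r (q ℕ.* l) ⟨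
  b ^ (r ℕ.+ q ℕ.* l)    ≡⟨ cong (b ^_) (m≡m%n+[m/n]*n j l) ⟨
  b ^ j                  ≈⟨ killsʲ b b⊥n ⟩
  1ℤ                     ∎
  where
  open ≡-mod-Reasoning (+ n)
  r = j % l
  q = j / l
  b^ql≡1 : b ^ (q ℕ.* l) ≡ 1ℤ mod + n
  b^ql≡1 = killsUnitsℤ-∣ (dividesℕ q refl) killsˡ b b⊥n

Least : ∀ {p} → Pred ℕ p → Pred ℕ p
Least P i = P i × (∀ {m} → P m → i ≤ m)

least-witness : ∀ {p} {P : Pred ℕ p} → Decidable P → ∀ {j} → P j → ∃ (Least P)
least-witness {P = P} P? {j} = <-rec (λ j → P j → ∃ (Least P)) search j
  where
  search : ∀ j → (∀ {i} → i ℕ.< j → P i → ∃ (Least P)) → P j → ∃ (Least P)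
  search j smaller Pj with anyUpTo? P? j
  ... | yes (i , i<j , Pi) = smaller i<j Pi
  ... | no  ∄i<j           = j , Pj , λ {m} Pm → ≮⇒≥ (λ m<j → ∄i<j (m , m<j , Pm))

module _ {n : ℕ} .{{_ : NonZero n}} where

  killsUnits? : Decidable (KillsUnits n)
  killsUnits? j = Dec.map′ (λ kills a → kills {a}) (λ kills {a} → kills a)
    (allUpTo? (λ a → coprime? a n Dec.→-dec (a ℕ.^ j % n ≟ 1 % n)) n)

  carmichaelλ-exists : ∀ {j} → 0 ℕ.< j → KillsUnits n j → ∃ (IsCarmichaelλ n)
  carmichaelλ-exists 0<j kills
    with least-witness (λ i → 0 <? i Dec.×-dec killsUnits? i) (0<j , kills)
  ... | l , (0<l , killsˡ) , least = l , 0<l , killsˡ , λ m 0<m killsᵐ → least (0<m , killsᵐ)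

  killsUnits⇒carmichaelλ∣ : ∀ {l j} → IsCarmichaelλ n l → KillsUnits n j → l ∣ℕ j
  killsUnits⇒carmichaelλ∣ {l} {j} (0<l , killsˡ , least) killsʲ = m%n≡0⇒n∣m j l j%l≡0
    where
    instance _ = ℕ.>-nonZero 0<l
    killsʳ : KillsUnits n (j % l)
    killsʳ = from (killsUnits⇔killsUnitsℤ (j % l))
      (killsUnitsℤ-% {l = l} {j} (to (killsUnits⇔killsUnitsℤ l) killsˡ)
                                 (to (killsUnits⇔killsUnitsℤ j) killsʲ))
    j%l≡0 : j % l ≡ 0
    j%l≡0 = n≤0⇒n≡0 (≮⇒≥ λ 0<r → <⇒≱ (m%n<n j l) (least (j % l) 0<r killsʳ))

  killsUnits⇔carmichaelλ∣ : ∀ {j} → 0 ℕ.< j →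
                            KillsUnits n j ⇔ ∃ λ l → IsCarmichaelλ n l × l ∣ℕ j
  killsUnits⇔carmichaelλ∣ {j} 0<j = mk⇔
    (λ kills → let l , isλ = carmichaelλ-exists 0<j kills
               in  l , isλ , killsUnits⇒carmichaelλ∣ isλ kills)
    (λ (l , (_ , killsˡ , _) , l∣j) →
      from (killsUnits⇔killsUnitsℤ j) (killsUnitsℤ-∣ l∣j (to (killsUnits⇔killsUnitsℤ l) killsˡ)))

module _ {n : ℕ} .{{_ : NonZero n}} (squareFree : SquareFree n) where

  squareFree-square∣⇒≡1 : ∀ {i} → i ℕ.* i ∣ℕ n → i ≡ 1
  squareFree-square∣⇒≡1 {0} 0∣n = ⊥-elim (ℕ.≢-nonZero⁻¹ n (0∣⇒≡0 0∣n))
  squareFree-square∣⇒≡1 {1} _   = refl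
  squareFree-square∣⇒≡1 {i@(suc (suc _))} i²∣n with factorise i
  ... | record { factors = [] ; isFactorisation = () }
  ... | record { factors = p ∷ ps ; isFactorisation = i≡p*∏ps ; factorsPrime = p-prime ∷ _ } =
    ⊥-elim (squareFree p p-prime (∣-trans (*-pres-∣ p∣i p∣i) i²∣n))
    where
    p∣i : p ∣ℕ i
    p∣i = dividesℕ (product ps) (trans i≡p*∏ps (ℕ.*-comm p (product ps)))

  squareFree-factors-coprime : ∀ {d e} → d ℕ.* e ≡ n → Coprime d e
  squareFree-factors-coprime de≡n (i∣d , i∣e) =
    squareFree-square∣⇒≡1 (subst (_ ∣ℕ_) de≡n (*-pres-∣ i∣d i∣e))

^suc≡id⇒squareFree : ∀ {n m} → 0 ℕ.< m → (∀ a → a ^ suc m ≡ a mod + n) → SquareFree n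
^suc≡id⇒squareFree {n} {suc m} _ fermat p p-prime p²∣n =
  ¬prime[1] (subst Prime (∣1⇒≡1 p∣1) p-prime)
  where
  instance _ = prime⇒nonZero p-prime
  p²∣p^2+m : + (p ℕ.* p) ∣ₛ (+ p) ^ suc (suc m)
  p²∣p^2+m = divides ((+ p) ^ m)
    (trans (regroup (+ p) ((+ p) ^ m)) (cong ((+ p) ^ m *_) (sym (pos-* p p))))
    where
    regroup : ∀ x y → x * (x * y) ≡ y * (x * x)
    regroup = solve-∀
  p²∣p : + (p ℕ.* p) ∣ₛ + p
  p²∣p = subst (_ ∣ₛ_) (cancel ((+ p) ^ suc (suc m)) (+ p))
    (∣m∣n⇒∣m-n p²∣p^2+m (∣-difference (≡-mod-∣ (ℤ∣.∣ᵤ⇒∣ p²∣n) (fermat (+ p)))))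
    where
    cancel : ∀ x y → x - (x - y) ≡ y
    cancel = solve-∀
  p∣1 : p ∣ℕ 1
  p∣1 = *-cancelˡ-∣ p (subst (p ℕ.* p ∣ℕ_) (sym (ℕ.*-identityʳ p)) (ℤ∣.∣⇒∣ᵤ p²∣p))

^suc≡id⇒killsUnitsℤ : ∀ {n m} → (∀ a → a ^ suc m ≡ a mod + n) → KillsUnitsℤ n m
^suc≡id⇒killsUnitsℤ {n} {m} fermat b b⊥n =
  mod∣ (ℤ∣.∣ᵤ⇒∣ (ℤCoprimality.coprime-divisor (+ n) b (b ^ m - 1ℤ)
    (Coprimality.sym b⊥n) (ℤ∣.∣⇒∣ᵤ n∣b[b^m-1])))
  where
  n∣b[b^m-1] : + n ∣ₛ b * (b ^ m - 1ℤ)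
  n∣b[b^m-1] = subst (+ n ∣ₛ_) (x*y-x≡x*[y-1] b (b ^ m)) (∣-difference (fermat b))

coprime-+-cofactor : ∀ {n e} a → gcd ∣ a ∣ n ℕ.* e ≡ n → Coprime (gcd ∣ a ∣ n) e →
                     Coprime ∣ a + + e ∣ n
coprime-+-cofactor {n} {e} a ge≡n g⊥e {i} (i∣a+e , i∣n) = g⊥e (i∣g , i∣e)
  where
  g = gcd ∣ a ∣ n
  g∣a : + g ∣ₛ a
  g∣a = ℤ∣.∣ᵤ⇒∣ (gcd[m,n]∣m ∣ a ∣ n)
  i⊥g : Coprime i g
  i⊥g {j} (j∣i , j∣g) = g⊥e (j∣g , ℤ∣.∣⇒∣ᵤ (∣m+n∣m⇒∣n
    (ℤ∣.∣ᵤ⇒∣ {+ j} {a + + e} (∣-trans j∣i i∣a+e)) (ℤ∣.∣-trans (ℤ∣.∣ᵤ⇒∣ {+ j} {+ g} j∣g) g∣a)))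
  i∣e : i ∣ℕ e
  i∣e = coprime-divisor i⊥g (subst (i ∣ℕ_) (sym ge≡n) i∣n)
  i∣g : i ∣ℕ g
  i∣g = gcd-greatest
    (ℤ∣.∣⇒∣ᵤ {+ i} {a} (∣m+n∣n⇒∣m (ℤ∣.∣ᵤ⇒∣ {+ i} {a + + e} i∣a+e) (ℤ∣.∣ᵤ⇒∣ {+ i} {+ e} i∣e)))
    i∣n

∣∧^≡1⇒^suc≡id : ∀ {g e m a} → + g ∣ₛ a → a ^ m ≡ 1ℤ mod + e → a ^ suc m ≡ a mod + (g ℕ.* e)
∣∧^≡1⇒^suc≡id {g} {e} {m} {a} g∣a (mod∣ e∣a^m-1) =
  mod∣ (subst₂ _∣ₛ_ (sym (pos-* g e)) (sym (x*y-x≡x*[y-1] a (a ^ m)))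
    (ℤ∣.∣-trans (ℤ∣.*-monoˡ-∣ (+ e) g∣a) (ℤ∣.*-monoʳ-∣ a e∣a^m-1)))

squareFree∧killsUnitsℤ⇒^suc≡id : ∀ {n m} .{{_ : NonZero n}} → SquareFree n → KillsUnitsℤ n m →
                                 ∀ a → a ^ suc m ≡ a mod + n
squareFree∧killsUnitsℤ⇒^suc≡id {n} {m} squareFree kills a =
  subst (λ t → a ^ suc m ≡ a mod + t) ge≡n (∣∧^≡1⇒^suc≡id {m = m} g∣a a^m≡1)
  where
  g∣n = gcd[m,n]∣n ∣ a ∣ n
  g = gcd ∣ a ∣ n
  e = _∣ℕ_.quotient g∣n
  ge≡n : g ℕ.* e ≡ n
  ge≡n = sym (trans (_∣ℕ_.equality g∣n) (ℕ.*-comm e g))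
  g∣a : + g ∣ₛ a
  g∣a = ℤ∣.∣ᵤ⇒∣ (gcd[m,n]∣m ∣ a ∣ n)
  e∣n : + e ∣ₛ + n
  e∣n = ℤ∣.∣ᵤ⇒∣ (dividesℕ g (sym ge≡n))
  a+e⊥n : Coprime ∣ a + + e ∣ n
  a+e⊥n = coprime-+-cofactor a ge≡n (squareFree-factors-coprime squareFree ge≡n)
  a^m≡1 : a ^ m ≡ 1ℤ mod + e
  a^m≡1 = begin
    a ^ m          ≈⟨ ^-cong-mod m (≡-mod-sym ≡-mod-+-modulus) ⟩
    (a + + e) ^ m  ≈⟨ ≡-mod-∣ e∣n (kills (a + + e) a+e⊥n) ⟩
    1ℤ             ∎
    where open ≡-mod-Reasoning (+ e)

^suc≡id⇔squareFree×killsUnits : ∀ {n m} .{{_ : NonZero n}} → 0 ℕ.< m →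
  (∀ a → a ^ suc m ≡ a mod + n) ⇔ (SquareFree n × KillsUnits n m)
^suc≡id⇔squareFree×killsUnits {m = m} 0<m = mk⇔
  (λ fermat → ^suc≡id⇒squareFree 0<m fermat ,
              from (killsUnits⇔killsUnitsℤ m) (^suc≡id⇒killsUnitsℤ {m = m} fermat))
  (λ (squareFree , kills) →
     squareFree∧killsUnitsℤ⇒^suc≡id {m = m} squareFree (to (killsUnits⇔killsUnitsℤ m) kills))

i<j⇒0<∣j-i∣ : ∀ {i j} → i < j → 0 ℕ.< ∣ j - i ∣
i<j⇒0<∣j-i∣ {i} {j} i<j =
  n≢0⇒n>0 (λ ∣j-i∣≡0 → <-irrefl (sym (i-j≡0⇒i≡j j i (∣i∣≡0⇒i≡0 ∣j-i∣≡0))) i<j)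

proposition2p1 : (k : ℤ) (n : ℕ) .{{_ : NonZero n}} → k < + n →
    (∀ (a : ℤ) → (+ n) ∣ ((a ^ Data.Nat.suc ∣ (+ n) - k ∣) - a))
    ⇔ (SquareFree n × ∃ λ L → IsCarmichaelλ n L × L ∣ℕ ∣ (+ n) - k ∣)
proposition2p1 k n k<n = begin
  (∀ a → + n ∣ a ^ suc n-k - a)                          ≈⟨ pointwise ∣⇔≡-mod ⟩
  (∀ a → a ^ suc n-k ≡ a mod + n)                        ≈⟨ ^suc≡id⇔squareFree×killsUnits 0<n-k ⟩
  (SquareFree n × KillsUnits n n-k)                      ≈⟨ ⇔-id _ ×-⇔ killsUnits⇔carmichaelλ∣ 0<n-k ⟩
  (SquareFree n × ∃ λ L → IsCarmichaelλ n L × L ∣ℕ n-k)  ∎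
  where
  open SetoidReasoning (⇔-setoid 0ℓ)
  n-k = ∣ + n - k ∣
  0<n-k = i<j⇒0<∣j-i∣ k<n
  pointwise : ∀ {A B : ℤ → Set} → (∀ {a} → A a ⇔ B a) → (∀ a → A a) ⇔ (∀ a → B a)
  pointwise A⇔B = mk⇔ (λ f a → to A⇔B (f a)) (λ g a → from A⇔B (g a))
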